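{- Let $m\ge n\ge 1$ and let $K_{m,n}$ have partite sets $X,Y$ with $|X|=m$, $|Y|=n$. If $G$ is a subgraph of $K_{m,n}$ that is $P_4$-saturated relative to $K_{m,n}$, then $|E(G)|\le m+n-\alpha'(G)$. Moreover, if $G$ contains both an $X$-star and a $Y$-star, or if $G$ contains an isolated edge, then $|E(G)|=m+n-\alpha'(G)$.
   Context: $P_4$ is the path on $4$ vertices. A subgraph $G\subseteq K_{m,n}$ (spanning all vertices of $K_{m,n}$) is $P_4$-saturated relative to $K_{m,n}$ if $G$ contains no $P_4$ but adding any edge of $K_{m,n}$ not in $G$ creates a copy of $P_4$. $\alpha'(G)$ denotes the maximum size of a matching in $G$. An $X$-star (respectively $Y$-star) is a star subgraph (here, a component of $G$) having at least two leaves in $X$ (respectively in $Y$). An isolated edge is a component of $G$ consisting of a single edge. -}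

module Defs where

open import Data.Nat using (ℕ; _+_; _≤_)
open import Data.Fin using (Fin; _≟_)
open import Data.Bool using (Bool; true; false; _∨_; _∧_; if_then_else_)
open import Data.List using (List; map; allFin)
open import Data.Nat.ListAction using (sum)
open import Data.Product using (Σ; ∃; ∃-syntax; _×_)
open import Data.Sum using (_⊎_)
open import Relation.Binary.PropositionalEquality using (_≡_; _≢_)
open import Relation.Nullary.Decidable using (⌊_⌋)
open import Function.Definitions using (Injective)

-- A spanning subgraph G of K_{m,n} with parts X = Fin m, Y = Fin n,
-- given by its edge indicator: G x y ≡ true iff xy ∈ E(G).
BipGraph : ℕ → ℕ → Set
BipGraph m n = Fin m → Fin n → Bool

module _ {m n : ℕ} where

  Edge : BipGraph m n → Fin m → Fin n → Set
  Edge G x y = G x y ≡ true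

  -- In a bipartite graph every
  -- path on 4 vertices has the form x1 - y1 - x2 - y2 with x1 ≠ x2 in X,
  -- y1 ≠ y2 in Y (the reversed reading y-x-y-x is the same path).
  HasP4 : BipGraph m n → Set
  HasP4 G = ∃[ x₁ ] ∃[ x₂ ] ∃[ y₁ ] ∃[ y₂ ]
    (x₁ ≢ x₂ × y₁ ≢ y₂ × Edge G x₁ y₁ × Edge G x₂ y₁ × Edge G x₂ y₂)

  addEdge : BipGraph m n → Fin m → Fin n → BipGraph m n
  addEdge G x y i j = G i j ∨ (⌊ i ≟ x ⌋ ∧ ⌊ j ≟ y ⌋)

  P4Saturated : BipGraph m n → Set
  P4Saturated G = (HasP4 G → Data.Empty.⊥) × (∀ x y → G x y ≡ false → HasP4 (addEdge G x y))
    where import Data.Empty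

  edgeCount : BipGraph m n → ℕ
  edgeCount G = sum (map (λ x → sum (map (λ y → if G x y then 1 else 0) (allFin n))) (allFin m))

  Matching : BipGraph m n → ℕ → Set
  Matching G k = Σ (Fin k → Fin m) λ f → Σ (Fin k → Fin n) λ g →
    Injective _≡_ _≡_ f × Injective _≡_ _≡_ g × (∀ i → Edge G (f i) (g i))

  IsMatchingNumber : BipGraph m n → ℕ → Set
  IsMatchingNumber G a = Matching G a × (∀ k → Matching G k → k ≤ a)

  OnlyNbrOfX : BipGraph m n → Fin m → Fin n → Set
  OnlyNbrOfX G x y = ∀ y' → Edge G x y' → y' ≡ y

  OnlyNbrOfY : BipGraph m n → Fin n → Fin m → Set
  OnlyNbrOfY G y x = ∀ x' → Edge G x' y → x' ≡ x

  -- X-star: a component of G which is a star with ≥ 2 leaves in X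
  -- (hence its centre y lies in Y, and the component is y together with
  -- its neighbours, each of which has y as its only neighbour).
  HasXStar : BipGraph m n → Set
  HasXStar G = ∃[ y ] ∃[ x₁ ] ∃[ x₂ ]
    (x₁ ≢ x₂ × Edge G x₁ y × Edge G x₂ y × (∀ x → Edge G x y → OnlyNbrOfX G x y))

  -- Y-star: a component of G which is a star with ≥ 2 leaves in Y.
  HasYStar : BipGraph m n → Set
  HasYStar G = ∃[ x ] ∃[ y₁ ] ∃[ y₂ ]
    (y₁ ≢ y₂ × Edge G x y₁ × Edge G x y₂ × (∀ y → Edge G x y → OnlyNbrOfY G y x))

  HasIsolatedEdge : BipGraph m n → Set
  HasIsolatedEdge G = ∃[ x ] ∃[ y ] (Edge G x y × OnlyNbrOfX G x y × OnlyNbrOfY G y x)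

module Submission where

-- Let G be P4-free.  Call x ∈ X a leaf when deg x = 1, and call y ∈ Y
-- covered when y has a neighbour that is not a leaf.  Because G has no
-- P4, a non-leaf x is the only neighbour of each of its neighbours, so
-- every edge xy is counted exactly once by "x is a leaf" or "y is
-- covered":  |E(G)| = #leaves + #covered.  Hence |E(G)| + |U| = m + n,
-- where U, the set of uncovered vertices, consists of the non-leaves of
-- X and the uncovered vertices of Y.
--   * Every matching injects into U (send the matching edge xy to y if x
--     is a leaf and to x otherwise), so |E(G)| + α'(G) ≤ m + n.
--   * If G has no isolated vertex, choosing one edge at each vertex of U
--     gives a matching of size |U|, so equality holds.
-- Saturation excludes isolated vertices as soon as each side contains a
-- vertex all of whose neighbours are pendant on it; stars on both sides,
-- or an isolated edge, provide such vertices.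

open import Defs
open import Data.Nat using (ℕ; zero; suc; _+_; _∸_; _≤_; _<_; z≤n; s≤s; s≤s⁻¹)
open import Data.Nat.Properties
  using (+-0-commutativeMonoid; +-commutativeSemigroup; <-irrefl; +-monoʳ-≤; ≤-antisym; m+n≤o⇒m≤o∸n; m+n∸n≡m)
open import Algebra.Properties.CommutativeMonoid.Sum +-0-commutativeMonoid
  using (sum-syntax; sum-remove; sum-replicate-zero; ∑-distrib-+; ∑-comm; sum-cong-≗)
open import Algebra.Properties.CommutativeSemigroup +-commutativeSemigroup using (interchange)
open import Data.Fin using (Fin; zero; suc; splitAt; join; _↑ˡ_; _↑ʳ_; punchIn)
open import Data.Fin.Properties
  using (_≟_; any?; suc-injective; injective⇒≤; punchInᵢ≢i; punchIn-punchOut; splitAt-↑ˡ; splitAt-↑ʳ; join-splitAt)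
open import Data.Bool using (Bool; true; false; not; _∧_; _∨_; if_then_else_)
open import Data.Bool.Properties using (∧-comm; ∧-identityʳ; ∧-zeroʳ; ∧-conicalˡ; ∧-conicalʳ; not-involutive; ¬-not)
import Data.Bool.Properties as Bool
open import Data.List using (map; allFin; tabulate)
open import Data.List.Properties using (map-tabulate)
open import Data.Nat.ListAction using () renaming (sum to listSum)
open import Data.Product using (Σ; ∃; ∃₂; _×_; _,_; proj₁; proj₂)
open import Data.Sum using (_⊎_; inj₁; inj₂)
import Data.Sum as Sum
open import Data.Sum.Properties using (inj₁-injective; inj₂-injective)
open import Data.Empty using (⊥-elim)
open import Function using (_∘_)
open import Function.Definitions using (Injective)
open import Relation.Nullary using (¬_; yes; no; contradiction)
open import Relation.Nullary.Decidable using (⌊_⌋)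
open import Relation.Binary.PropositionalEquality

ind : Bool → ℕ
ind b = if b then 1 else 0

not-true : ∀ {b} → not b ≡ true → b ≡ false
not-true {b} q = trans (sym (not-involutive b)) (cong not q)

count : ∀ {N} → (Fin N → Bool) → ℕ
count {N} p = ∑[ i < N ] ind (p i)

listSum-tabulate : ∀ N (h : Fin N → ℕ) → listSum (tabulate h) ≡ ∑[ i < N ] h i
listSum-tabulate zero h = refl
listSum-tabulate (suc N) h = cong (h zero +_) (listSum-tabulate N (h ∘ suc))

listSum-allFin : ∀ N (h : Fin N → ℕ) → listSum (map h (allFin N)) ≡ ∑[ i < N ] h i
listSum-allFin N h = trans (cong listSum (map-tabulate (λ i → i) h)) (listSum-tabulate N h)

∑-one : ∀ N → ∑[ i < N ] 1 ≡ N
∑-one zero = refl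
∑-one (suc N) = cong suc (∑-one N)

count-complement : ∀ {N} (p : Fin N → Bool) → count p + count (not ∘ p) ≡ N
count-complement {N} p = begin
  count p + count (not ∘ p)                 ≡⟨ sym (∑-distrib-+ (ind ∘ p) (ind ∘ not ∘ p)) ⟩
  ∑[ i < N ] (ind (p i) + ind (not (p i)))  ≡⟨ sum-cong-≗ (λ i → ind+ind-not (p i)) ⟩
  ∑[ i < N ] 1                              ≡⟨ ∑-one N ⟩
  N                                         ∎
  where
  open ≡-Reasoning
  ind+ind-not : ∀ b → ind b + ind (not b) ≡ 1
  ind+ind-not true = refl
  ind+ind-not false = refl

count-∧-const : ∀ {N} (p : Fin N → Bool) b → count (λ i → p i ∧ b) ≡ (if b then count p else 0)
count-∧-const p true = sum-cong-≗ (λ i → cong ind (∧-identityʳ (p i)))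
count-∧-const {N} p false = trans (sum-cong-≗ (λ i → cong ind (∧-zeroʳ (p i)))) (sum-replicate-zero N)

count-remove : ∀ {N} (p : Fin (suc N) → Bool) {i} → p i ≡ true → count p ≡ suc (count (p ∘ punchIn i))
count-remove p {i} pᵢ = trans (sum-remove {i = i} (ind ∘ p)) (cong (λ b → ind b + count (p ∘ punchIn i)) pᵢ)

witness⇒count-pos : ∀ {N} (p : Fin N → Bool) {i} → p i ≡ true → 0 < count p
witness⇒count-pos {zero} p {()} _
witness⇒count-pos {suc N} p pᵢ rewrite count-remove p pᵢ = s≤s z≤n

count-pos⇒witness : ∀ {N} (p : Fin N → Bool) → 0 < count p → ∃ λ i → p i ≡ true
count-pos⇒witness {zero} p ()
count-pos⇒witness {suc N} p pos with p zero in p₀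
... | true = zero , p₀
... | false = let (i , pᵢ) = count-pos⇒witness (p ∘ suc) pos in suc i , pᵢ

other-witness : ∀ {N} (p : Fin N → Bool) {i} → p i ≡ true → 1 < count p → ∃ λ j → j ≢ i × p j ≡ true
other-witness {zero} p {()} _ _
other-witness {suc N} p {i} pᵢ more =
  let (k , pₖ) = count-pos⇒witness (p ∘ punchIn i) (s≤s⁻¹ (subst (1 <_) (count-remove p pᵢ) more))
  in punchIn i k , punchInᵢ≢i i k , pₖ

distinct-witnesses : ∀ {N} (p : Fin N → Bool) {i j} → i ≢ j → p i ≡ true → p j ≡ true → 1 < count p
distinct-witnesses {zero} p {()} _ _ _
distinct-witnesses {suc N} p {i} i≢j pᵢ pⱼ rewrite count-remove p pᵢ =
  s≤s (witness⇒count-pos (p ∘ punchIn i) (trans (cong p (punchIn-punchOut i≢j)) pⱼ))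

nonzero : ℕ → Bool
nonzero zero = false
nonzero (suc _) = true

count-atMostOne : ∀ {N} (p : Fin N → Bool) → (∀ {i j} → p i ≡ true → p j ≡ true → i ≡ j) →
                  count p ≡ ind (nonzero (count p))
count-atMostOne p unique with count p in c
... | zero = refl
... | suc zero = refl
... | suc (suc _) =
  let (i , pᵢ) = count-pos⇒witness p (subst (0 <_) (sym c) (s≤s z≤n))
      (j , j≢i , pⱼ) = other-witness p pᵢ (subst (1 <_) (sym c) (s≤s (s≤s z≤n)))
  in ⊥-elim (j≢i (unique pⱼ pᵢ))

record Enumeration {A : Set} (p : A → Bool) (C : ℕ) : Set where
  field
    elem : Fin C → A
    injective : Injective _≡_ _≡_ elem
    sound : ∀ k → p (elem k) ≡ true
    complete : ∀ a → p a ≡ true → ∃ λ k → elem k ≡ a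

enumeration-bound : ∀ {A : Set} {p : A → Bool} {C k} → Enumeration p C →
                    (φ : Fin k → A) → Injective _≡_ _≡_ φ → (∀ i → p (φ i) ≡ true) → k ≤ C
enumeration-bound {C = C} {k} E φ φ-injective φ-sound = injective⇒≤ {f = index} index-injective
  where
  open Enumeration E
  index : Fin k → Fin C
  index i = proj₁ (complete (φ i) (φ-sound i))
  index-injective : Injective _≡_ _≡_ index
  index-injective {i} {j} q = φ-injective (begin
    φ i                  ≡⟨ sym (proj₂ (complete (φ i) (φ-sound i))) ⟩
    elem (index i)       ≡⟨ cong elem q ⟩
    elem (index j)       ≡⟨ proj₂ (complete (φ j) (φ-sound j)) ⟩
    φ j                  ∎)
    where open ≡-Reasoning

enumeration-cons : ∀ {N C} (p : Fin (suc N) → Bool) → Enumeration (p ∘ suc) C →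
                   Enumeration p (ind (p zero) + C)
enumeration-cons {N} {C} p E with p zero in p₀
... | false = record
  { elem = suc ∘ elem ; injective = injective ∘ suc-injective ; sound = sound ; complete = complete′ }
  where
  open Enumeration E
  complete′ : ∀ i → p i ≡ true → ∃ λ k → suc (elem k) ≡ i
  complete′ zero pᵢ = contradiction (trans (sym p₀) pᵢ) λ ()
  complete′ (suc i) pᵢ = let (k , q) = complete i pᵢ in k , cong suc q
... | true = record { elem = elem′ ; injective = injective′ ; sound = sound′ ; complete = complete′ }
  where
  open Enumeration E
  elem′ : Fin (suc C) → Fin (suc N)
  elem′ zero = zero
  elem′ (suc k) = suc (elem k)
  injective′ : Injective _≡_ _≡_ elem′
  injective′ {zero} {zero} _ = refl
  injective′ {suc k} {suc l} q = cong suc (injective (suc-injective q))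
  injective′ {zero} {suc _} ()
  injective′ {suc _} {zero} ()
  sound′ : ∀ k → p (elem′ k) ≡ true
  sound′ zero = p₀
  sound′ (suc k) = sound k
  complete′ : ∀ i → p i ≡ true → ∃ λ k → elem′ k ≡ i
  complete′ zero _ = zero , refl
  complete′ (suc i) pᵢ = let (k , q) = complete i pᵢ in suc k , cong suc q

enumerate : ∀ {N} (p : Fin N → Bool) → Enumeration p (count p)
enumerate {zero} p = record { elem = λ () ; injective = λ {} ; sound = λ () ; complete = λ () }
enumerate {suc N} p = enumeration-cons p (enumerate (p ∘ suc))

enumeration-⊎ : ∀ {A B : Set} {p : A ⊎ B → Bool} {C₁ C₂} →
                Enumeration (p ∘ inj₁) C₁ → Enumeration (p ∘ inj₂) C₂ → Enumeration p (C₁ + C₂)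
enumeration-⊎ {A} {B} {p} {C₁} {C₂} E₁ E₂ = record { elem = elem ; injective = injective ; sound = sound ; complete = complete }
  where
  module E₁ = Enumeration E₁
  module E₂ = Enumeration E₂
  elem : Fin (C₁ + C₂) → A ⊎ B
  elem k = Sum.map E₁.elem E₂.elem (splitAt C₁ k)
  map-injective : ∀ {u v} → Sum.map E₁.elem E₂.elem u ≡ Sum.map E₁.elem E₂.elem v → u ≡ v
  map-injective {inj₁ _} {inj₁ _} q = cong inj₁ (E₁.injective (inj₁-injective q))
  map-injective {inj₂ _} {inj₂ _} q = cong inj₂ (E₂.injective (inj₂-injective q))
  injective : Injective _≡_ _≡_ elem
  injective {k} {l} q = begin
    k                           ≡⟨ sym (join-splitAt C₁ C₂ k) ⟩
    join C₁ C₂ (splitAt C₁ k)   ≡⟨ cong (join C₁ C₂) (map-injective {splitAt C₁ k} {splitAt C₁ l} q) ⟩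
    join C₁ C₂ (splitAt C₁ l)   ≡⟨ join-splitAt C₁ C₂ l ⟩
    l                           ∎
    where open ≡-Reasoning
  sound : ∀ k → p (elem k) ≡ true
  sound k with splitAt C₁ k
  ... | inj₁ k₁ = E₁.sound k₁
  ... | inj₂ k₂ = E₂.sound k₂
  complete : ∀ u → p u ≡ true → ∃ λ k → elem k ≡ u
  complete (inj₁ a) pa = let (k , q) = E₁.complete a pa in
    k ↑ˡ C₂ , trans (cong (Sum.map E₁.elem E₂.elem) (splitAt-↑ˡ C₁ k C₂)) (cong inj₁ q)
  complete (inj₂ b) pb = let (k , q) = E₂.complete b pb in
    C₁ ↑ʳ k , trans (cong (Sum.map E₁.elem E₂.elem) (splitAt-↑ʳ C₁ C₂ k)) (cong inj₂ q)

isOne : ℕ → Bool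
isOne 1 = true
isOne _ = false

isOne-sound : ∀ {d} → isOne d ≡ true → d ≡ 1
isOne-sound {1} _ = refl

notOne-pos : ∀ {d} → isOne d ≡ false → 0 < d → 1 < d
notOne-pos {suc (suc _)} _ _ = s≤s (s≤s z≤n)

isOne-split : ∀ d → d ≡ ind (isOne d) + (if not (isOne d) then d else 0)
isOne-split zero = refl
isOne-split 1 = refl
isOne-split (suc (suc _)) = refl

module _ {m n : ℕ} (G : BipGraph m n) where

  deg : Fin m → ℕ
  deg x = count (G x)

  leaf : Fin m → Bool
  leaf x = isOne (deg x)

  leaf-unique : ∀ {x y y'} → leaf x ≡ true → Edge G x y → Edge G x y' → y ≡ y'
  leaf-unique {x} {y} {y'} lx e e' with y ≟ y'
  ... | yes y≡y' = y≡y'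
  ... | no y≢y' = contradiction (subst (1 <_) (isOne-sound lx) (distinct-witnesses (G x) y≢y' e e')) (<-irrefl refl)

  nonleaf-other : ∀ {x y} → leaf x ≡ false → Edge G x y → ∃ λ y' → y' ≢ y × Edge G x y'
  nonleaf-other {x} lx e = other-witness (G x) e (notOne-pos lx (witness⇒count-pos (G x) e))

  degree-split : ∀ x → deg x ≡ ind (leaf x) + count (λ y → G x y ∧ not (leaf x))
  degree-split x = trans (isOne-split (deg x)) (cong (ind (leaf x) +_) (sym (count-∧-const (G x) (not (leaf x)))))

  nonleafNbr : Fin n → Fin m → Bool
  nonleafNbr y x = G x y ∧ not (leaf x)

  covered : Fin n → Bool
  covered y = nonzero (count (nonleafNbr y))

  covered-witness : ∀ {y} → covered y ≡ true → ∃ λ x → Edge G x y × leaf x ≡ false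
  covered-witness {y} cy with count (nonleafNbr y) in c
  ... | suc _ = let (x , q) = count-pos⇒witness (nonleafNbr y) (subst (0 <_) (sym c) (s≤s z≤n))
                in x , ∧-conicalˡ _ _ q , not-true (∧-conicalʳ _ _ q)

  witness-covered : ∀ {x y} → Edge G x y → leaf x ≡ false → covered y ≡ true
  witness-covered {x} {y} e lx with count (nonleafNbr y) in c
  ... | zero = contradiction (subst (0 <_) c (witness⇒count-pos (nonleafNbr y) q)) λ ()
    where
    q : nonleafNbr y x ≡ true
    q rewrite e | lx = refl
  ... | suc _ = refl

  uncovered-nbr-leaf : ∀ {x y} → not (covered y) ≡ true → Edge G x y → leaf x ≡ true
  uncovered-nbr-leaf {x} uy e with leaf x in lx
  ... | true = refl
  ... | false = contradiction (witness-covered e lx) (Bool.not-¬ (not-true uy))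

  Uncovered : Fin m ⊎ Fin n → Bool
  Uncovered (inj₁ x) = not (leaf x)
  Uncovered (inj₂ y) = not (covered y)

  #uncovered : ℕ
  #uncovered = count (not ∘ leaf) + count (not ∘ covered)

  enumerate-uncovered : Enumeration Uncovered #uncovered
  enumerate-uncovered = enumeration-⊎ (enumerate (not ∘ leaf)) (enumerate (not ∘ covered))

  module _ (p4-free : ¬ HasP4 G) where

    nonleaf-private : ∀ {x x' y} → Edge G x y → Edge G x' y → leaf x' ≡ false → x ≡ x'
    nonleaf-private {x} {x'} {y} e e' lx' with x ≟ x'
    ... | yes x≡x' = x≡x'
    ... | no x≢x' = let (y' , y'≢y , e'') = nonleaf-other lx' e' in
      ⊥-elim (p4-free (x , x' , y , y' , x≢x' , y'≢y ∘ sym , e , e' , e''))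

    -- Hence each y has at most one non-leaf neighbour.
    count-nonleafNbr : ∀ y → count (nonleafNbr y) ≡ ind (covered y)
    count-nonleafNbr y = count-atMostOne (nonleafNbr y) λ q q' →
      nonleaf-private (∧-conicalˡ _ _ q) (∧-conicalˡ _ _ q') (not-true (∧-conicalʳ _ _ q'))

    -- Every edge is counted once: by its leaf end in X, or else by its covered end in Y.
    edgeCount-split : edgeCount G ≡ count leaf + count covered
    edgeCount-split = begin
      edgeCount G                                          ≡⟨ listSum-allFin m _ ⟩
      ∑[ x < m ] listSum (map (λ y → ind (G x y)) (allFin n)) ≡⟨ sum-cong-≗ (λ x → listSum-allFin n (ind ∘ G x)) ⟩
      ∑[ x < m ] deg x                                     ≡⟨ sum-cong-≗ degree-split ⟩
      ∑[ x < m ] (ind (leaf x) + count (λ y → G x y ∧ not (leaf x)))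
        ≡⟨ ∑-distrib-+ (ind ∘ leaf) _ ⟩
      count leaf + ∑[ x < m ] ∑[ y < n ] ind (nonleafNbr y x)
        ≡⟨ cong (count leaf +_) (∑-comm (λ x y → ind (nonleafNbr y x))) ⟩
      count leaf + ∑[ y < n ] count (nonleafNbr y)         ≡⟨ cong (count leaf +_) (sum-cong-≗ count-nonleafNbr) ⟩
      count leaf + count covered                           ∎
      where open ≡-Reasoning

    edgeCount-uncovered : edgeCount G + #uncovered ≡ m + n
    edgeCount-uncovered = begin
      edgeCount G + #uncovered                                          ≡⟨ cong (_+ #uncovered) edgeCount-split ⟩
      (count leaf + count covered) + (count (not ∘ leaf) + count (not ∘ covered))
        ≡⟨ interchange (count leaf) (count covered) _ _ ⟩
      (count leaf + count (not ∘ leaf)) + (count covered + count (not ∘ covered))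
        ≡⟨ cong₂ _+_ (count-complement leaf) (count-complement covered) ⟩
      m + n                                                             ∎
      where open ≡-Reasoning

    owner : Fin m → Fin n → Fin m ⊎ Fin n
    owner x y = if leaf x then inj₂ y else inj₁ x

    -- The owner is uncovered (P4-freeness excludes a covered y next to a leaf), and
    -- edges with distinct X- and Y-ends have distinct owners.
    owner-uncovered : ∀ {x y} → Edge G x y → Uncovered (owner x y) ≡ true
    owner-uncovered {x} {y} e with leaf x in lx
    ... | false = cong not lx
    ... | true with covered y in cy
    ...   | false = refl
    ...   | true = let (x' , e' , lx') = covered-witness cy in
      contradiction (trans (sym lx) (trans (cong leaf (nonleaf-private e e' lx')) lx')) λ ()

    owner-injective : ∀ {x x' y y'} → owner x y ≡ owner x' y' → x ≡ x' ⊎ y ≡ y'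
    owner-injective {x} {x'} q with leaf x | leaf x'
    ... | true | true = inj₂ (inj₂-injective q)
    ... | false | false = inj₁ (inj₁-injective q)

    -- Owners of distinct matching edges are distinct, so a matching injects into U.
    edgeCount-bound : ∀ {k} → Matching G k → edgeCount G + k ≤ m + n
    edgeCount-bound {k} (f , g , f-injective , g-injective , edge) =
      subst (edgeCount G + k ≤_) edgeCount-uncovered (+-monoʳ-≤ (edgeCount G)
        (enumeration-bound enumerate-uncovered (λ i → owner (f i) (g i)) φ-injective (λ i → owner-uncovered (edge i))))
      where
      φ-injective : Injective _≡_ _≡_ (λ i → owner (f i) (g i))
      φ-injective q = Sum.[ f-injective , g-injective ] (owner-injective q)

    -- Without isolated vertices, one chosen edge at each uncovered vertex forms a matching.
    module _ (nbrX : ∀ x → ∃ λ y → Edge G x y) (nbrY : ∀ y → ∃ λ x → Edge G x y) where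

      endX : Fin m ⊎ Fin n → Fin m
      endX (inj₁ x) = x
      endX (inj₂ y) = proj₁ (nbrY y)

      endY : Fin m ⊎ Fin n → Fin n
      endY (inj₁ x) = proj₁ (nbrX x)
      endY (inj₂ y) = y

      end-edge : ∀ u → Edge G (endX u) (endY u)
      end-edge (inj₁ x) = proj₂ (nbrX x)
      end-edge (inj₂ y) = proj₂ (nbrY y)

      -- a non-leaf x is never the chosen (leaf) neighbour of an uncovered y
      endX-apart : ∀ {x y} → Uncovered (inj₁ x) ≡ true → Uncovered (inj₂ y) ≡ true → x ≢ endX (inj₂ y)
      endX-apart ux uy refl = contradiction (uncovered-nbr-leaf uy (end-edge (inj₂ _))) (Bool.not-¬ (not-true ux))

      endX-injective : ∀ {u v} → Uncovered u ≡ true → Uncovered v ≡ true → endX u ≡ endX v → u ≡ v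
      endX-injective {inj₁ x} {inj₁ x'} _ _ q = cong inj₁ q
      endX-injective {inj₁ x} {inj₂ y} ux uy q = contradiction q (endX-apart ux uy)
      endX-injective {inj₂ y} {inj₁ x} uy ux q = contradiction (sym q) (endX-apart ux uy)
      endX-injective {inj₂ y} {inj₂ y'} uy _ q = cong inj₂ (leaf-unique (uncovered-nbr-leaf uy (end-edge (inj₂ y)))
        (end-edge (inj₂ y)) (subst (λ x → Edge G x y') (sym q) (end-edge (inj₂ y'))))

      -- the chosen neighbour of a non-leaf x is covered
      endY-apart : ∀ {x y} → Uncovered (inj₁ x) ≡ true → Uncovered (inj₂ y) ≡ true → endY (inj₁ x) ≢ y
      endY-apart ux uy refl = contradiction (witness-covered (end-edge (inj₁ _)) (not-true ux)) (Bool.not-¬ (not-true uy))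

      endY-injective : ∀ {u v} → Uncovered u ≡ true → Uncovered v ≡ true → endY u ≡ endY v → u ≡ v
      endY-injective {inj₁ x} {inj₁ x'} _ ux' q = cong inj₁ (nonleaf-private (end-edge (inj₁ x))
        (subst (Edge G x') (sym q) (end-edge (inj₁ x'))) (not-true ux'))
      endY-injective {inj₁ x} {inj₂ y} ux uy q = contradiction q (endY-apart ux uy)
      endY-injective {inj₂ y} {inj₁ x} uy ux q = contradiction (sym q) (endY-apart ux uy)
      endY-injective {inj₂ y} {inj₂ y'} _ _ q = cong inj₂ q

      uncovered-matching : Matching G #uncovered
      uncovered-matching =
        endX ∘ elem , endY ∘ elem
        , (λ {k} {l} q → injective (endX-injective (sound k) (sound l) q))
        , (λ {k} {l} q → injective (endY-injective (sound k) (sound l) q))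
        , end-edge ∘ elem
        where open Enumeration enumerate-uncovered

module _ {m n : ℕ} where

  Saturating : BipGraph m n → Set
  Saturating G = ∀ x y → G x y ≡ false → HasP4 (addEdge G x y)

  PendantCentre : BipGraph m n → Fin n → Set
  PendantCentre G y = ∀ x → Edge G x y → OnlyNbrOfX G x y

  addEdge-inv : ∀ (G : BipGraph m n) {x y i j} → Edge (addEdge G x y) i j → Edge G i j ⊎ (i ≡ x × j ≡ y)
  addEdge-inv G {x} {y} {i} {j} q with G i j | i ≟ x | j ≟ y
  ... | true | _ | _ = inj₁ refl
  ... | false | yes i≡x | yes j≡y = inj₂ (i≡x , j≡y)

  p4-at-isolated : ∀ (G : BipGraph m n) {x y} → ¬ HasP4 G → (∀ y' → G x y' ≡ false) →
                   HasP4 (addEdge G x y) → ∃₂ λ x' y' → Edge G x' y × Edge G x' y' × y' ≢ y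
  p4-at-isolated G p4-free iso (x₁ , x₂ , y₁ , y₂ , x₁≢x₂ , y₁≢y₂ , e₁ , e₂ , e₃)
    with addEdge-inv G e₁ | addEdge-inv G e₂ | addEdge-inv G e₃
  ... | inj₁ g₁ | inj₁ g₂ | inj₁ g₃ = ⊥-elim (p4-free (x₁ , x₂ , y₁ , y₂ , x₁≢x₂ , y₁≢y₂ , g₁ , g₂ , g₃))
  ... | inj₂ (refl , refl) | inj₁ g₂ | inj₁ g₃ = x₂ , y₂ , g₂ , g₃ , y₁≢y₂ ∘ sym
  ... | _ | inj₂ (refl , _) | inj₁ g₃ = contradiction (trans (sym g₃) (iso y₂)) λ ()
  ... | _ | inj₂ (_ , refl) | inj₂ (_ , refl) = ⊥-elim (y₁≢y₂ refl)
  ... | _ | inj₁ g₂ | inj₂ (refl , refl) = contradiction (trans (sym g₂) (iso y₁)) λ ()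

  no-isolated-X : ∀ (G : BipGraph m n) {y₀} → ¬ HasP4 G → Saturating G → PendantCentre G y₀ →
                  ∀ x → ∃ λ y → Edge G x y
  no-isolated-X G {y₀} p4-free saturating centre x with any? (λ y → G x y Bool.≟ true)
  ... | yes nbr = nbr
  ... | no isolated =
    let iso y = ¬-not (λ e → isolated (y , e))
        (x' , y' , e , e' , y'≢y₀) = p4-at-isolated G p4-free iso (saturating x y₀ (iso y₀))
    in ⊥-elim (y'≢y₀ (centre x' e y' e'))

transpose : ∀ {m n} → BipGraph m n → BipGraph n m
transpose G y x = G x y

p4-transpose : ∀ {m n} {G : BipGraph m n} → HasP4 G → HasP4 (transpose G)
p4-transpose (x₁ , x₂ , y₁ , y₂ , x₁≢x₂ , y₁≢y₂ , e₁ , e₂ , e₃) =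
  y₂ , y₁ , x₂ , x₁ , y₁≢y₂ ∘ sym , x₁≢x₂ ∘ sym , e₃ , e₂ , e₁

p4-cong : ∀ {m n} {G H : BipGraph m n} → (∀ i j → G i j ≡ H i j) → HasP4 G → HasP4 H
p4-cong G≗H (x₁ , x₂ , y₁ , y₂ , x₁≢x₂ , y₁≢y₂ , e₁ , e₂ , e₃) =
  x₁ , x₂ , y₁ , y₂ , x₁≢x₂ , y₁≢y₂ ,
  trans (sym (G≗H x₁ y₁)) e₁ , trans (sym (G≗H x₂ y₁)) e₂ , trans (sym (G≗H x₂ y₂)) e₃

saturating-transpose : ∀ {m n} {G : BipGraph m n} → Saturating G → Saturating (transpose G)
saturating-transpose {G = G} saturating y x e =
  p4-cong (λ j i → cong (G i j ∨_) (∧-comm ⌊ i ≟ x ⌋ ⌊ j ≟ y ⌋)) (p4-transpose (saturating x y e))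

centres : ∀ {m n} (G : BipGraph m n) → (HasXStar G × HasYStar G) ⊎ HasIsolatedEdge G →
          Σ (Fin n) (PendantCentre G) × Σ (Fin m) (PendantCentre (transpose G))
centres G (inj₁ ((y₀ , _ , _ , _ , _ , _ , starX) , (x₀ , _ , _ , _ , _ , _ , starY))) = (y₀ , starX) , (x₀ , starY)
centres G (inj₂ (x₀ , y₀ , _ , onlyX , onlyY)) =
  (y₀ , λ x e y e' → onlyX y (subst (λ x → Edge G x y) (onlyY x e) e')) ,
  (x₀ , λ y e x e' → onlyY x (subst (Edge G x) (onlyX y e) e'))

no-isolated : ∀ {m n} (G : BipGraph m n) → ¬ HasP4 G → Saturating G → (HasXStar G × HasYStar G) ⊎ HasIsolatedEdge G →
              (∀ x → ∃ λ y → Edge G x y) × (∀ y → ∃ λ x → Edge G x y)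
no-isolated G p4-free saturating hyp =
  let ((y₀ , centreY) , (x₀ , centreX)) = centres G hyp in
  no-isolated-X G p4-free saturating centreY ,
  no-isolated-X (transpose G) (p4-free ∘ p4-transpose) (saturating-transpose saturating) centreX

-- The theorem.

mainTheorem6 : (m n : ℕ) → n ≤ m → 1 ≤ n → (G : BipGraph m n) → P4Saturated G → (a : ℕ) → IsMatchingNumber G a →
    (edgeCount G ≤ m + n ∸ a)
    × ((HasXStar G × HasYStar G) ⊎ HasIsolatedEdge G → edgeCount G ≡ m + n ∸ a)
mainTheorem6 m n _ _ G (p4-free , saturating) a (maximum , maximal) = m+n≤o⇒m≤o∸n (edgeCount G) upper , equality
  where
  upper : edgeCount G + a ≤ m + n
  upper = edgeCount-bound G p4-free maximum

  equality : (HasXStar G × HasYStar G) ⊎ HasIsolatedEdge G → edgeCount G ≡ m + n ∸ a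
  equality hyp = trans (sym (m+n∸n≡m (edgeCount G) a)) (cong (_∸ a) (≤-antisym upper lower))
    where
    nbrs : (∀ x → ∃ λ y → Edge G x y) × (∀ y → ∃ λ x → Edge G x y)
    nbrs = no-isolated G p4-free saturating hyp
    lower : m + n ≤ edgeCount G + a
    lower = subst (_≤ edgeCount G + a) (edgeCount-uncovered G p4-free)
      (+-monoʳ-≤ (edgeCount G) (maximal _ (uncovered-matching G p4-free (proj₁ nbrs) (proj₂ nbrs))))
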